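{- Let $\mathbb F$ be a field and define $P_n:=z^2\bigl(y\,\mathrm{HC}_n+y^2\,\mathrm{HC}_n^2\bigr)$, where $y,z$ are variables distinct from the variables of $\mathrm{HC}_n$. Then $(P)\notin\mathrm{VNPC}(\leq_{\mathsf p})$.
   Context: Hamiltonian cycle polynomial and VNP. $\mathrm{HC}_n=\sum_{\pi}\prod_{i=1}^n x_{i,\pi(i)}$, where $\pi$ ranges over the $n$-cycles in $\mathfrak S_n$. VNP is the set of $\mathsf p$-families (sequences of polynomials with polynomially bounded number of variables and degree) that are $\mathsf p$-projections of $(\mathrm{HC})$. Projections. $f\le g$ means $f$ is obtained from $g$ by substituting each variable of $g$ by a variable or a field constant. $(f)\leq_{\mathsf p}(g)$ means there is a polynomially bounded $t$ with $f_n\le g_{t(n)}$ for all $n$. Complete families. $\mathrm{VNPC}(\leq_{\mathsf p})=\{(f)\in\mathrm{VNP}:(\mathrm{HC})\leq_{\mathsf p}(f)\}$. -}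

module Defs where

open import Level using (Level; _⊔_) renaming (suc to lsuc)
open import Algebra.Bundles using (CommutativeRing)
open import Data.Nat as ℕ using (ℕ; zero; suc; _≤_; _^_)
open import Data.Fin using (Fin; combine; toℕ) renaming (zero to fz; suc to fs)
open import Data.Fin.Properties using (all?; any?) renaming (_≟_ to _≟F_)
open import Data.Vec using (Vec; []; _∷_; lookup)
open import Data.List using (List; []; _∷_; foldr; map; concatMap)
open import Data.Product using (Σ; ∃; ∃-syntax; _×_; _,_)
open import Data.Sum using (_⊎_; inj₁; inj₂)
open import Data.Bool using (Bool; true; false; if_then_else_)
open import Relation.Nullary using (¬_; Dec; does)
open import Relation.Nullary.Decidable using (_×-dec_; _→-dec_)
open import Relation.Binary.PropositionalEquality using (_≡_)

record Field (c ℓ : Level) : Set (lsuc (c ⊔ ℓ)) where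
  field
    commutativeRing : CommutativeRing c ℓ
  open CommutativeRing commutativeRing public
  field
    0≉1     : ¬ (0# ≈ 1#)
    inverse : ∀ x → ¬ (x ≈ 0#) → ∃[ y ] (x * y ≈ 1#)

-- The polynomial ring F[V]: terms over variables V and constants in F,
-- modulo the commutative-ring axioms and the requirement that the
-- constants form a copy of F (i.e. the free commutative F-algebra on V).

module Poly {c ℓ} (F : Field c ℓ) where
  open Field F using (_≈_; 0#; 1#) renaming (Carrier to K; _+_ to _+K_; _*_ to _*K_; -_ to -K_)

  infixl 6 _⊕_
  infixl 7 _⊗_
  infix 4 _≃_

  data Pol (V : Set) : Set c where
    var   : V → Pol V
    const : K → Pol V
    _⊕_   : Pol V → Pol V → Pol V
    _⊗_   : Pol V → Pol V → Pol V

  module _ {V : Set} where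
    𝟘 𝟙 : Pol V
    𝟘 = const 0#
    𝟙 = const 1#

  data _≃_ {V : Set} : Pol V → Pol V → Set (c ⊔ ℓ) where
    ≃-refl  : ∀ {p} → p ≃ p
    ≃-sym   : ∀ {p q} → p ≃ q → q ≃ p
    ≃-trans : ∀ {p q r} → p ≃ q → q ≃ r → p ≃ r
    ⊕-cong  : ∀ {p p′ q q′} → p ≃ p′ → q ≃ q′ → p ⊕ q ≃ p′ ⊕ q′
    ⊗-cong  : ∀ {p p′ q q′} → p ≃ p′ → q ≃ q′ → p ⊗ q ≃ p′ ⊗ q′
    ⊕-assoc : ∀ p q r → (p ⊕ q) ⊕ r ≃ p ⊕ (q ⊕ r)
    ⊕-comm  : ∀ p q → p ⊕ q ≃ q ⊕ p
    ⊕-idˡ   : ∀ p → 𝟘 ⊕ p ≃ p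
    ⊕-invʳ  : ∀ p → p ⊕ (const (-K 1#) ⊗ p) ≃ 𝟘
    ⊗-assoc : ∀ p q r → (p ⊗ q) ⊗ r ≃ p ⊗ (q ⊗ r)
    ⊗-comm  : ∀ p q → p ⊗ q ≃ q ⊗ p
    ⊗-idˡ   : ∀ p → 𝟙 ⊗ p ≃ p
    ⊗-distribʳ : ∀ p q r → (q ⊕ r) ⊗ p ≃ (q ⊗ p) ⊕ (r ⊗ p)
    const-cong : ∀ {a b} → a ≈ b → const a ≃ const b
    const-+ : ∀ a b → const (a +K b) ≃ const a ⊕ const b
    const-* : ∀ a b → const (a *K b) ≃ const a ⊗ const b

  sdeg : ∀ {V} → Pol V → ℕ
  sdeg (var _)   = 1
  sdeg (const _) = 0
  sdeg (p ⊕ q)   = sdeg p ℕ.⊔ sdeg q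
  sdeg (p ⊗ q)   = sdeg p ℕ.+ sdeg q

  DegreeAtMost : ∀ {V} → ℕ → Pol V → Set (c ⊔ ℓ)
  DegreeAtMost d p = ∃[ q ] (q ≃ p × sdeg q ≤ d)

  subst : ∀ {V W} → (W → Pol V) → Pol W → Pol V
  subst σ (var x)   = σ x
  subst σ (const a) = const a
  subst σ (p ⊕ q)   = subst σ p ⊕ subst σ q
  subst σ (p ⊗ q)   = subst σ p ⊗ subst σ q

  _≼_ : ∀ {V W} → Pol V → Pol W → Set (c ⊔ ℓ)
  _≼_ {V} {W} f g =
    Σ (W → V ⊎ K) (λ σ → subst {V} {W} (λ w → [var,const] (σ w)) g ≃ f)
    where
      [var,const] : V ⊎ K → Pol V
      [var,const] (inj₁ v) = var v
      [var,const] (inj₂ a) = const a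

  record Family : Set c where
    field
      nvars : ℕ → ℕ
      poly  : (n : ℕ) → Pol (Fin (nvars n))
  open Family public

  PolyBounded : (ℕ → ℕ) → Set
  PolyBounded t = ∃[ k ] (∀ n → t n ≤ k ℕ.* n ^ k ℕ.+ k)

  IsPFamily : Family → Set (c ⊔ ℓ)
  IsPFamily f = PolyBounded (nvars f)
              × ∃[ d ] (PolyBounded d × ∀ n → DegreeAtMost (d n) (poly f n))

  _≤ₚ_ : Family → Family → Set (c ⊔ ℓ)
  f ≤ₚ g = ∃[ t ] (PolyBounded t × ∀ n → poly f n ≼ poly g (t n))

  sumP : ∀ {V} → List (Pol V) → Pol V
  sumP = foldr _⊕_ 𝟘

  prodF : ∀ {V} n → (Fin n → Pol V) → Pol V
  prodF zero    f = 𝟙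
  prodF (suc n) f = f fz ⊗ prodF n (λ i → f (fs i))

  allVecs : ∀ n k → List (Vec (Fin n) k)
  allVecs n zero    = [] ∷ []
  allVecs n (suc k) =
    concatMap (λ v → map (λ i → i ∷ v) (allFinL n)) (allVecs n k)
    where
      allFinL : ∀ m → List (Fin m)
      allFinL zero    = []
      allFinL (suc m) = fz ∷ map fs (allFinL m)

  iter : ∀ {n} → (Fin n → Fin n) → ℕ → Fin n → Fin n
  iter π zero    i = i
  iter π (suc k) i = π (iter π k i)

  -- π : Fin n → Fin n is an n-cycle: a permutation (injective) such that
  -- every j lies in the orbit of every i (iterates below n suffice)
  IsNCycle : ∀ {n} → (Fin n → Fin n) → Set
  IsNCycle {n} π = (∀ i j → π i ≡ π j → i ≡ j)
                 × (∀ i j → ∃[ k ] (iter π (toℕ {n} k) i ≡ j))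

  isNCycle? : ∀ {n} (π : Fin n → Fin n) → Dec (IsNCycle π)
  isNCycle? π =
    all? (λ i → all? (λ j → (π i ≟F π j) →-dec (i ≟F j)))
    ×-dec all? (λ i → all? (λ j → any? (λ k → iter π (toℕ k) i ≟F j)))

  HC : (n : ℕ) → Pol (Fin (n ℕ.* n))
  HC n = sumP (map term (allVecs n n))
    where
      term : Vec (Fin n) n → Pol (Fin (n ℕ.* n))
      term v = if does (isNCycle? (lookup v))
               then prodF n (λ i → var (combine i (lookup v i)))
               else 𝟘

  HCfam : Family
  HCfam = record { nvars = λ n → n ℕ.* n ; poly = HC }

  InVNP : Family → Set (c ⊔ ℓ)
  InVNP f = IsPFamily f × (f ≤ₚ HCfam)

  InVNPC : Family → Set (c ⊔ ℓ)
  InVNPC f = InVNP f × (HCfam ≤ₚ f)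

  P : (n : ℕ) → Pol (Fin (2 ℕ.+ n ℕ.* n))
  P n = (z ⊗ z) ⊗ ((y ⊗ h) ⊕ ((y ⊗ y) ⊗ (h ⊗ h)))
    where
      y z h : Pol (Fin (2 ℕ.+ n ℕ.* n))
      y = var fz
      z = var (fs fz)
      h = subst (λ x → var (fs (fs x))) (HC n)

  Pfam : Family
  Pfam = record { nvars = λ n → 2 ℕ.+ n ℕ.* n ; poly = P }

module Submission where

-- Substituting a single indeterminate X for every variable is a ring map from F[V] to
-- F[[X]] (realised as ℕ → F with the Cauchy product) whose image consists of series of
-- finite support. A projection HC₁ = x₁₁ ≤ P_m thus yields z̄²(u + u²) = X, where u is the
-- finitely supported image of y·HC_m and z̄, the image of z, is X or a constant a. For
-- z̄ = X the left side is divisible by X². For z̄ = a we get a ≠ 0; a constant u leaves no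
-- X-term on the left, and if u has degree D ≥ 1 the coefficient of X^{2D} on the left is
-- a²·u_D² ≠ 0 although 2D ≥ 2.

open import Defs
open import Level using (Level)
open import Algebra.Bundles using (CommutativeRing; CommutativeSemigroup)
open import Data.Nat as ℕ using (ℕ; zero; suc; _<_; _≤_; _⊔_; z≤n; s≤s)
open import Data.Nat.Properties using (≤-trans; ≤-<-trans; <⇒≤; m≤m⊔n; m≤n⊔m; m≤n+m; m≤n⇒m<n∨m≡n)
open import Data.Fin using (Fin) renaming (zero to fz; suc to fs)
open import Data.Sum using (_⊎_; inj₁; inj₂)
open import Data.Product using (∃-syntax; _,_; _×_; proj₂)
open import Relation.Nullary using (¬_; yes; no)
open import Relation.Nullary.Decidable using (¬¬-excluded-middle)
open import Relation.Binary.Structures using (IsEquivalence)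
open import Relation.Binary.PropositionalEquality using () renaming (refl to ≡-refl)
import Algebra.Properties.Ring as RingProperties
import Algebra.Properties.CommutativeSemigroup as CommutativeSemigroupProperties
import Relation.Binary.Reasoning.Setoid as SetoidReasoning

module PowerSeries {c ℓ} (R : CommutativeRing c ℓ) where
  open CommutativeRing R hiding (zero)
  open SetoidReasoning setoid

  infix  4 _≋_
  infixl 6 _+ₛ_
  infixl 7 _⋆_ _·ₛ_

  Series : Set c
  Series = ℕ → Carrier

  _≋_ : Series → Series → Set ℓ
  f ≋ g = ∀ n → f n ≈ g n

  ≋-isEquivalence : IsEquivalence _≋_
  ≋-isEquivalence = record
    { refl  = λ _ → refl
    ; sym   = λ f≋g n → sym (f≋g n)
    ; trans = λ f≋g g≋h n → trans (f≋g n) (g≋h n)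
    }

  0ₛ : Series
  0ₛ _ = 0#

  constant : Carrier → Series
  constant a zero    = a
  constant a (suc _) = 0#

  X : Series
  X zero          = 0#
  X (suc zero)    = 1#
  X (suc (suc _)) = 0#

  tail : Series → Series
  tail f n = f (suc n)

  shift : Series → Series
  shift f zero    = 0#
  shift f (suc n) = f n

  _+ₛ_ : Series → Series → Series
  (f +ₛ g) n = f n + g n

  _·ₛ_ : Carrier → Series → Series
  (a ·ₛ f) n = a * f n

  _⋆_ : Series → Series → Series
  (f ⋆ g) zero    = f 0 * g 0
  (f ⋆ g) (suc n) = f 0 * g (suc n) + (tail f ⋆ g) n

  ⋆-unfoldˡ : ∀ f g → f ⋆ g ≋ f 0 ·ₛ g +ₛ shift (tail f ⋆ g)
  ⋆-unfoldˡ f g zero    = sym (+-identityʳ _)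
  ⋆-unfoldˡ f g (suc n) = refl

  ⋆-unfoldʳ : ∀ f g → f ⋆ g ≋ g 0 ·ₛ f +ₛ shift (f ⋆ tail g)
  ⋆-unfoldʳ f g zero    = trans (*-comm _ _) (sym (+-identityʳ _))
  ⋆-unfoldʳ f g (suc n) = begin
    f 0 * g (suc n) + (tail f ⋆ g) n                               ≈⟨ +-congˡ (⋆-unfoldʳ (tail f) g n) ⟩
    f 0 * g (suc n) + (g 0 * f (suc n) + shift (tail f ⋆ tail g) n) ≈⟨ x∙yz≈y∙xz _ _ _ ⟩
    g 0 * f (suc n) + (f 0 * g (suc n) + shift (tail f ⋆ tail g) n) ≈⟨ +-congˡ (⋆-unfoldˡ f (tail g) n) ⟨
    g 0 * f (suc n) + (f ⋆ tail g) n                               ∎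
    where open CommutativeSemigroupProperties +-commutativeSemigroup using (x∙yz≈y∙xz)

  ⋆-cong : ∀ {f f′ g g′} → f ≋ f′ → g ≋ g′ → f ⋆ g ≋ f′ ⋆ g′
  ⋆-cong f≋f′ g≋g′ zero    = *-cong (f≋f′ 0) (g≋g′ 0)
  ⋆-cong f≋f′ g≋g′ (suc n) = +-cong (*-cong (f≋f′ 0) (g≋g′ (suc n))) (⋆-cong (λ k → f≋f′ (suc k)) g≋g′ n)

  ⋆-congˡ : ∀ f {g g′} → g ≋ g′ → f ⋆ g ≋ f ⋆ g′
  ⋆-congˡ f = ⋆-cong (λ _ → refl)

  ⋆-congʳ : ∀ {f f′} g → f ≋ f′ → f ⋆ g ≋ f′ ⋆ g
  ⋆-congʳ g f≋f′ = ⋆-cong f≋f′ (λ _ → refl)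

  constant-cong : ∀ {a b} → a ≈ b → constant a ≋ constant b
  constant-cong a≈b zero    = a≈b
  constant-cong a≈b (suc n) = refl

  constant-0# : constant 0# ≋ 0ₛ
  constant-0# zero    = refl
  constant-0# (suc n) = refl

  constant-+ : ∀ a b → constant (a + b) ≋ constant a +ₛ constant b
  constant-+ a b zero    = refl
  constant-+ a b (suc n) = sym (+-identityˡ 0#)

  ⋆-zeroˡ : ∀ {f} g → f ≋ 0ₛ → f ⋆ g ≋ 0ₛ
  ⋆-zeroˡ g f≋0 zero    = trans (*-congʳ (f≋0 0)) (zeroˡ _)
  ⋆-zeroˡ g f≋0 (suc n) =
    trans (+-cong (trans (*-congʳ (f≋0 0)) (zeroˡ _)) (⋆-zeroˡ g (λ k → f≋0 (suc k)) n)) (+-identityˡ 0#)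

  constant-⋆ : ∀ a g → constant a ⋆ g ≋ a ·ₛ g
  constant-⋆ a g zero    = refl
  constant-⋆ a g (suc n) = trans (+-congˡ (⋆-zeroˡ g (λ _ → refl) n)) (+-identityʳ _)

  ⋆-distribʳ : ∀ f f′ g → (f +ₛ f′) ⋆ g ≋ f ⋆ g +ₛ f′ ⋆ g
  ⋆-distribʳ f f′ g zero    = distribʳ (g 0) (f 0) (f′ 0)
  ⋆-distribʳ f f′ g (suc n) =
    trans (+-cong (distribʳ _ _ _) (⋆-distribʳ (tail f) (tail f′) g n)) (interchange _ _ _ _)
    where open CommutativeSemigroupProperties +-commutativeSemigroup using (interchange)

  ·ₛ-⋆ : ∀ a f g → (a ·ₛ f) ⋆ g ≋ a ·ₛ (f ⋆ g)
  ·ₛ-⋆ a f g zero    = *-assoc a (f 0) (g 0)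
  ·ₛ-⋆ a f g (suc n) = trans (+-cong (*-assoc _ _ _) (·ₛ-⋆ a (tail f) g n)) (sym (distribˡ a _ _))

  shift-⋆ : ∀ f g → shift f ⋆ g ≋ shift (f ⋆ g)
  shift-⋆ f g zero    = zeroˡ _
  shift-⋆ f g (suc n) = trans (+-congʳ (zeroˡ _)) (+-identityˡ _)

  ⋆-assoc-step : ∀ f g h n → shift ((tail f ⋆ g) ⋆ h) n ≈ shift (tail f ⋆ (g ⋆ h)) n →
                 ((f ⋆ g) ⋆ h) n ≈ (f ⋆ (g ⋆ h)) n
  ⋆-assoc-step f g h n tail-assoc = begin
    ((f ⋆ g) ⋆ h) n                                     ≈⟨ ⋆-congʳ h (⋆-unfoldˡ f g) n ⟩
    ((f 0 ·ₛ g +ₛ shift (tail f ⋆ g)) ⋆ h) n            ≈⟨ ⋆-distribʳ _ _ h n ⟩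
    ((f 0 ·ₛ g) ⋆ h) n + (shift (tail f ⋆ g) ⋆ h) n      ≈⟨ +-cong (·ₛ-⋆ (f 0) g h n) (shift-⋆ _ h n) ⟩
    f 0 * (g ⋆ h) n + shift ((tail f ⋆ g) ⋆ h) n         ≈⟨ +-congˡ tail-assoc ⟩
    f 0 * (g ⋆ h) n + shift (tail f ⋆ (g ⋆ h)) n         ≈⟨ ⋆-unfoldˡ f (g ⋆ h) n ⟨
    (f ⋆ (g ⋆ h)) n                                     ∎

  ⋆-assoc : ∀ f g h → (f ⋆ g) ⋆ h ≋ f ⋆ (g ⋆ h)
  ⋆-assoc f g h zero    = ⋆-assoc-step f g h zero refl
  ⋆-assoc f g h (suc n) = ⋆-assoc-step f g h (suc n) (⋆-assoc (tail f) g h n)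

  ⋆-comm-step : ∀ f g n → shift (tail f ⋆ tail g) n ≈ shift (tail g ⋆ tail f) n →
                (f ⋆ g) (suc n) ≈ (g ⋆ f) (suc n)
  ⋆-comm-step f g n tail-comm = begin
    f 0 * g (suc n) + (tail f ⋆ g) n                               ≈⟨ +-congˡ (⋆-unfoldʳ (tail f) g n) ⟩
    f 0 * g (suc n) + (g 0 * f (suc n) + shift (tail f ⋆ tail g) n) ≈⟨ +-congˡ (+-congˡ tail-comm) ⟩
    f 0 * g (suc n) + (g 0 * f (suc n) + shift (tail g ⋆ tail f) n) ≈⟨ x∙yz≈y∙xz _ _ _ ⟩
    g 0 * f (suc n) + (f 0 * g (suc n) + shift (tail g ⋆ tail f) n) ≈⟨ +-congˡ (⋆-unfoldʳ (tail g) f n) ⟨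
    g 0 * f (suc n) + (tail g ⋆ f) n                               ∎
    where open CommutativeSemigroupProperties +-commutativeSemigroup using (x∙yz≈y∙xz)

  ⋆-comm : ∀ f g → f ⋆ g ≋ g ⋆ f
  ⋆-comm f g zero          = *-comm _ _
  ⋆-comm f g (suc zero)    = ⋆-comm-step f g zero refl
  ⋆-comm f g (suc (suc n)) = ⋆-comm-step f g (suc n) (⋆-comm (tail f) (tail g) n)

  ⋆-commutativeSemigroup : CommutativeSemigroup c ℓ
  ⋆-commutativeSemigroup = record
    { Carrier = Series
    ; _≈_     = _≋_
    ; _∙_     = _⋆_
    ; isCommutativeSemigroup = record
      { isSemigroup = record
        { isMagma = record { isEquivalence = ≋-isEquivalence ; ∙-cong = ⋆-cong }
        ; assoc   = ⋆-assoc
        }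
      ; comm = ⋆-comm
      }
    }

  constant-* : ∀ a b → constant (a * b) ≋ constant a ⋆ constant b
  constant-* a b zero    = refl
  constant-* a b (suc n) = sym (trans (constant-⋆ a (constant b) (suc n)) (zeroʳ a))

  tail-X : tail X ≋ constant 1#
  tail-X zero    = refl
  tail-X (suc n) = refl

  X-⋆ : ∀ f → X ⋆ f ≋ shift f
  X-⋆ f zero    = zeroˡ (f 0)
  X-⋆ f (suc n) = begin
    0# * f (suc n) + (tail X ⋆ f) n  ≈⟨ +-cong (zeroˡ _) (⋆-congʳ f tail-X n) ⟩
    0# + (constant 1# ⋆ f) n         ≈⟨ +-identityˡ _ ⟩
    (constant 1# ⋆ f) n              ≈⟨ constant-⋆ 1# f n ⟩
    1# * f n                         ≈⟨ *-identityˡ (f n) ⟩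
    f n                              ∎

  VanishesAbove : ℕ → Series → Set ℓ
  VanishesAbove d f = ∀ n → d < n → f n ≈ 0#

  vanishesAbove-mono : ∀ {d e f} → d ≤ e → VanishesAbove d f → VanishesAbove e f
  vanishesAbove-mono d≤e f↓ n e<n = f↓ n (≤-<-trans d≤e e<n)

  constant-vanishesAbove : ∀ a → VanishesAbove 0 (constant a)
  constant-vanishesAbove a (suc n) _ = refl

  X-vanishesAbove : VanishesAbove 1 X
  X-vanishesAbove (suc zero)    (s≤s ())
  X-vanishesAbove (suc (suc n)) _ = refl

  tail-vanishesAbove : ∀ {d f} → VanishesAbove (suc d) f → VanishesAbove d (tail f)
  tail-vanishesAbove f↓ n d<n = f↓ (suc n) (s≤s d<n)

  +ₛ-vanishesAbove : ∀ {d e f g} → VanishesAbove d f → VanishesAbove e g →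
                     VanishesAbove (d ⊔ e) (f +ₛ g)
  +ₛ-vanishesAbove {d} {e} f↓ g↓ n d⊔e<n = trans
    (+-cong (vanishesAbove-mono (m≤m⊔n d e) f↓ n d⊔e<n) (vanishesAbove-mono (m≤n⊔m d e) g↓ n d⊔e<n))
    (+-identityˡ 0#)

  vanishesAbove-0-⋆ : ∀ {f} g → VanishesAbove 0 f → f ⋆ g ≋ f 0 ·ₛ g
  vanishesAbove-0-⋆ {f} g f↓ n = begin
    (f ⋆ g) n                            ≈⟨ ⋆-unfoldˡ f g n ⟩
    f 0 * g n + shift (tail f ⋆ g) n      ≈⟨ +-congˡ (shift-0ₛ n) ⟩
    f 0 * g n + 0#                       ≈⟨ +-identityʳ _ ⟩
    f 0 * g n                            ∎
    where
      shift-0ₛ : shift (tail f ⋆ g) ≋ 0ₛ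
      shift-0ₛ zero    = refl
      shift-0ₛ (suc n) = ⋆-zeroˡ g (λ k → f↓ (suc k) (s≤s z≤n)) n

  ⋆-vanishesAbove : ∀ {d e} f g → VanishesAbove d f → VanishesAbove e g → VanishesAbove (d ℕ.+ e) (f ⋆ g)
  ⋆-vanishesAbove {zero} f g f↓ g↓ n e<n =
    trans (vanishesAbove-0-⋆ g f↓ n) (trans (*-congˡ (g↓ n e<n)) (zeroʳ _))
  ⋆-vanishesAbove {suc d} {e} f g f↓ g↓ (suc n) (s≤s d+e<n) = begin
    f 0 * g (suc n) + (tail f ⋆ g) n  ≈⟨ +-cong (*-congˡ (g↓ (suc n) e<1+n)) tail-f⋆g↓ ⟩
    f 0 * 0# + 0#                    ≈⟨ +-identityʳ _ ⟩
    f 0 * 0#                         ≈⟨ zeroʳ _ ⟩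
    0#                               ∎
    where
      e<1+n : e < suc n
      e<1+n = s≤s (≤-trans (m≤n+m e d) (<⇒≤ d+e<n))
      tail-f⋆g↓ : (tail f ⋆ g) n ≈ 0#
      tail-f⋆g↓ = ⋆-vanishesAbove (tail f) g (tail-vanishesAbove f↓) g↓ n d+e<n

  ⋆-leadingCoefficient : ∀ {d e} f g → VanishesAbove d f → VanishesAbove e g →
                         (f ⋆ g) (d ℕ.+ e) ≈ f d * g e
  ⋆-leadingCoefficient {zero} f g f↓ g↓ = vanishesAbove-0-⋆ g f↓ _
  ⋆-leadingCoefficient {suc d} {e} f g f↓ g↓ = begin
    f 0 * g (suc (d ℕ.+ e)) + (tail f ⋆ g) (d ℕ.+ e)  ≈⟨ +-cong (*-congˡ (g↓ _ (s≤s (m≤n+m e d)))) tail-f⋆g-lead ⟩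
    f 0 * 0# + f (suc d) * g e                      ≈⟨ +-congʳ (zeroʳ _) ⟩
    0# + f (suc d) * g e                            ≈⟨ +-identityˡ _ ⟩
    f (suc d) * g e                                 ∎
    where
      tail-f⋆g-lead : (tail f ⋆ g) (d ℕ.+ e) ≈ f (suc d) * g e
      tail-f⋆g-lead = ⋆-leadingCoefficient (tail f) g (tail-vanishesAbove f↓) g↓

  vanishesAbove-pred : ∀ {d f} → VanishesAbove (suc d) f → f (suc d) ≈ 0# → VanishesAbove d f
  vanishesAbove-pred f↓ f[1+d]≈0 n d<n with m≤n⇒m<n∨m≡n d<n
  ... | inj₁ 1+d<n = f↓ n 1+d<n
  ... | inj₂ ≡-refl = f[1+d]≈0

  constant-or-leadingCoefficient : ∀ {d f} → VanishesAbove d f →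
    ¬ ¬ (VanishesAbove 0 f ⊎ ∃[ e ] (f (suc e) ≉ 0# × VanishesAbove (suc e) f))
  constant-or-leadingCoefficient {zero}  f↓ k = k (inj₁ f↓)
  constant-or-leadingCoefficient {suc d} f↓ k = ¬¬-excluded-middle λ
    { (yes f[1+d]≈0) → constant-or-leadingCoefficient (vanishesAbove-pred f↓ f[1+d]≈0) k
    ; (no f[1+d]≉0)  → k (inj₂ (d , f[1+d]≉0 , f↓))
    }

module Evaluation {c ℓ} (F : Field c ℓ) where
  open Poly F
  open Field F hiding (zero)
  open PowerSeries commutativeRing
  open RingProperties ring using (-1*x≈-x)
  open SetoidReasoning setoid

  ⟦_⟧ : ∀ {V} → Pol V → Series
  ⟦ var _ ⟧   = X
  ⟦ const a ⟧ = constant a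
  ⟦ p ⊕ q ⟧   = ⟦ p ⟧ +ₛ ⟦ q ⟧
  ⟦ p ⊗ q ⟧   = ⟦ p ⟧ ⋆ ⟦ q ⟧

  ⟦⟧-cong : ∀ {V} {p q : Pol V} → p ≃ q → ⟦ p ⟧ ≋ ⟦ q ⟧
  ⟦⟧-cong ≃-refl              n = refl
  ⟦⟧-cong (≃-sym p≃q)         n = sym (⟦⟧-cong p≃q n)
  ⟦⟧-cong (≃-trans p≃q q≃r)   n = trans (⟦⟧-cong p≃q n) (⟦⟧-cong q≃r n)
  ⟦⟧-cong (⊕-cong p≃p′ q≃q′)  n = +-cong (⟦⟧-cong p≃p′ n) (⟦⟧-cong q≃q′ n)
  ⟦⟧-cong (⊗-cong p≃p′ q≃q′)  n = ⋆-cong (⟦⟧-cong p≃p′) (⟦⟧-cong q≃q′) n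
  ⟦⟧-cong (⊕-assoc p q r)     n = +-assoc _ _ _
  ⟦⟧-cong (⊕-comm p q)        n = +-comm _ _
  ⟦⟧-cong (⊕-idˡ p)           n = trans (+-congʳ (constant-0# n)) (+-identityˡ _)
  ⟦⟧-cong (⊕-invʳ p)          n = begin
    ⟦ p ⟧ n + (constant (- 1#) ⋆ ⟦ p ⟧) n  ≈⟨ +-congˡ (trans (constant-⋆ (- 1#) ⟦ p ⟧ n) (-1*x≈-x _)) ⟩
    ⟦ p ⟧ n - ⟦ p ⟧ n                     ≈⟨ -‿inverseʳ _ ⟩
    0#                                   ≈⟨ constant-0# n ⟨
    constant 0# n                        ∎
  ⟦⟧-cong (⊗-assoc p q r)     n = ⋆-assoc ⟦ p ⟧ ⟦ q ⟧ ⟦ r ⟧ n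
  ⟦⟧-cong (⊗-comm p q)        n = ⋆-comm ⟦ p ⟧ ⟦ q ⟧ n
  ⟦⟧-cong (⊗-idˡ p)           n = trans (constant-⋆ 1# ⟦ p ⟧ n) (*-identityˡ _)
  ⟦⟧-cong (⊗-distribʳ p q r)  n = ⋆-distribʳ ⟦ q ⟧ ⟦ r ⟧ ⟦ p ⟧ n
  ⟦⟧-cong (const-cong a≈b)    n = constant-cong a≈b n
  ⟦⟧-cong (const-+ a b)       n = constant-+ a b n
  ⟦⟧-cong (const-* a b)       n = constant-* a b n

  ⟦⟧-vanishesAbove : ∀ {V} (p : Pol V) → ∃[ d ] VanishesAbove d ⟦ p ⟧
  ⟦⟧-vanishesAbove (var _)   = 1 , X-vanishesAbove
  ⟦⟧-vanishesAbove (const a) = 0 , constant-vanishesAbove a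
  ⟦⟧-vanishesAbove (p ⊕ q) with ⟦⟧-vanishesAbove p | ⟦⟧-vanishesAbove q
  ... | d , p↓ | e , q↓ = d ⊔ e , +ₛ-vanishesAbove p↓ q↓
  ⟦⟧-vanishesAbove (p ⊗ q) with ⟦⟧-vanishesAbove p | ⟦⟧-vanishesAbove q
  ... | d , p↓ | e , q↓ = d ℕ.+ e , ⋆-vanishesAbove ⟦ p ⟧ ⟦ q ⟧ p↓ q↓

  ⟦HC₁⟧ : ⟦ HC 1 ⟧ ≋ X
  ⟦HC₁⟧ n = begin
    (X ⋆ constant 1#) n + constant 0# n  ≈⟨ +-cong (⋆-comm X (constant 1#) n) (constant-0# n) ⟩
    (constant 1# ⋆ X) n + 0#            ≈⟨ +-identityʳ _ ⟩
    (constant 1# ⋆ X) n                 ≈⟨ constant-⋆ 1# X n ⟩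
    1# * X n                            ≈⟨ *-identityˡ (X n) ⟩
    X n                                 ∎

  *-nonzero : ∀ {a b} → a ≉ 0# → b ≉ 0# → a * b ≉ 0#
  *-nonzero {a} {b} a≉0 b≉0 ab≈0 with inverse a a≉0
  ... | a⁻¹ , aa⁻¹≈1 = b≉0 (begin
    b              ≈⟨ *-identityˡ b ⟨
    1# * b         ≈⟨ *-congʳ (trans (sym aa⁻¹≈1) (*-comm a a⁻¹)) ⟩
    a⁻¹ * a * b    ≈⟨ *-assoc a⁻¹ a b ⟩
    a⁻¹ * (a * b)  ≈⟨ *-congˡ ab≈0 ⟩
    a⁻¹ * 0#       ≈⟨ zeroʳ a⁻¹ ⟩
    0#             ∎)

  c·[u+u⋆u]≉X : ∀ {d} c u → VanishesAbove d u → ¬ (c ·ₛ (u +ₛ u ⋆ u) ≋ X)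
  c·[u+u⋆u]≉X c u u↓ c·[u+u⋆u]≋X = constant-or-leadingCoefficient u↓ λ
    { (inj₁ u-constant)            → u-nonconstant u-constant
    ; (inj₂ (d , u[1+d]≉0 , u↓′)) → u-noLeadingCoefficient d u[1+d]≉0 u↓′
    }
    where
      c≉0 : c ≉ 0#
      c≉0 c≈0 = 0≉1 (begin
        0#                     ≈⟨ zeroˡ _ ⟨
        0# * (u 1 + (u ⋆ u) 1)  ≈⟨ *-congʳ c≈0 ⟨
        c * (u 1 + (u ⋆ u) 1)   ≈⟨ c·[u+u⋆u]≋X 1 ⟩
        1#                     ∎)

      u-nonconstant : ¬ VanishesAbove 0 u
      u-nonconstant u-constant = 0≉1 (begin
        0#                     ≈⟨ zeroʳ c ⟨
        c * 0#                 ≈⟨ *-congˡ (+-identityˡ 0#) ⟨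
        c * (0# + 0#)          ≈⟨ *-congˡ (+-cong (u-constant 1 (s≤s z≤n)) u⋆u↓) ⟨
        c * (u 1 + (u ⋆ u) 1)   ≈⟨ c·[u+u⋆u]≋X 1 ⟩
        1#                     ∎)
        where
          u⋆u↓ : (u ⋆ u) 1 ≈ 0#
          u⋆u↓ = ⋆-vanishesAbove u u u-constant u-constant 1 (s≤s z≤n)

      u-noLeadingCoefficient : ∀ d → u (suc d) ≉ 0# → ¬ VanishesAbove (suc d) u
      u-noLeadingCoefficient d u[1+d]≉0 u↓′ = *-nonzero c≉0 (*-nonzero u[1+d]≉0 u[1+d]≉0) (begin
        c * (u (suc d) * u (suc d))      ≈⟨ *-congˡ (+-identityˡ _) ⟨
        c * (0# + u (suc d) * u (suc d)) ≈⟨ *-congˡ (+-cong (u↓′ 2D 1+d<2D) (⋆-leadingCoefficient u u u↓′ u↓′)) ⟨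
        c * (u 2D + (u ⋆ u) 2D)          ≈⟨ c·[u+u⋆u]≋X 2D ⟩
        X 2D                             ≈⟨ X-vanishesAbove 2D (≤-<-trans (s≤s z≤n) 1+d<2D) ⟩
        0#                               ∎)
        where
          2D : ℕ
          2D = suc d ℕ.+ suc d
          1+d<2D : suc d < 2D
          1+d<2D = s≤s (m≤n+m (suc d) d)

  data Atomic {V : Set} : Pol V → Set c where
    atomic-var   : ∀ v → Atomic (var v)
    atomic-const : ∀ a → Atomic (const a)

  z²[yh+y²h²]≉X : ∀ {V} (z y h : Pol V) → Atomic z →
                  ¬ (⟦ (z ⊗ z) ⊗ ((y ⊗ h) ⊕ ((y ⊗ y) ⊗ (h ⊗ h))) ⟧ ≋ X)
  z²[yh+y²h²]≉X _ y h (atomic-var _) ⟦⟧≋X = 0≉1 (begin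
    0#                      ≡⟨⟩
    shift (shift ⟦ Q ⟧) 1    ≈⟨ X-⋆ (shift ⟦ Q ⟧) 1 ⟨
    (X ⋆ shift ⟦ Q ⟧) 1      ≈⟨ ⋆-congˡ X (X-⋆ ⟦ Q ⟧) 1 ⟨
    (X ⋆ (X ⋆ ⟦ Q ⟧)) 1      ≈⟨ ⋆-assoc X X ⟦ Q ⟧ 1 ⟨
    ((X ⋆ X) ⋆ ⟦ Q ⟧) 1      ≈⟨ ⟦⟧≋X 1 ⟩
    1#                      ∎)
    where
      Q : Pol _
      Q = (y ⊗ h) ⊕ ((y ⊗ y) ⊗ (h ⊗ h))
  z²[yh+y²h²]≉X _ y h (atomic-const a) ⟦⟧≋X =
    c·[u+u⋆u]≉X (a * a) (⟦ y ⟧ ⋆ ⟦ h ⟧) (proj₂ (⟦⟧-vanishesAbove (y ⊗ h))) λ n → begin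
      (a * a) * ((⟦ y ⟧ ⋆ ⟦ h ⟧) n + ((⟦ y ⟧ ⋆ ⟦ h ⟧) ⋆ (⟦ y ⟧ ⋆ ⟦ h ⟧)) n)
        ≈⟨ *-congˡ (+-congˡ (interchange ⟦ y ⟧ ⟦ y ⟧ ⟦ h ⟧ ⟦ h ⟧ n)) ⟨
      (a * a) * ⟦ Q ⟧ n                          ≈⟨ constant-⋆ (a * a) ⟦ Q ⟧ n ⟨
      (constant (a * a) ⋆ ⟦ Q ⟧) n               ≈⟨ ⋆-congʳ ⟦ Q ⟧ (constant-* a a) n ⟩
      ((constant a ⋆ constant a) ⋆ ⟦ Q ⟧) n      ≈⟨ ⟦⟧≋X n ⟩
      X n                                      ∎
    where
      open CommutativeSemigroupProperties ⋆-commutativeSemigroup using (interchange)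
      Q : Pol _
      Q = (y ⊗ h) ⊕ ((y ⊗ y) ⊗ (h ⊗ h))

  ¬atomic-image-of-z : ∀ m {ρ : Fin (2 ℕ.+ m ℕ.* m) → Pol (Fin 1)} →
                       subst ρ (P m) ≃ HC 1 → ¬ Atomic (ρ (fs fz))
  ¬atomic-image-of-z m {ρ} P≃HC₁ z-atomic =
    z²[yh+y²h²]≉X (ρ (fs fz)) (ρ fz) (subst ρ (subst (λ x → var (fs (fs x))) (HC m))) z-atomic
                  λ n → trans (⟦⟧-cong P≃HC₁ n) (⟦HC₁⟧ n)

  -- The substitution built from σ uses a function local to the definition of _≼_;
  -- abstracting σ (fs fz) also abstracts it in the type of the second scrutinee, so each
  -- branch sees the image of z as a literal variable or constant.
  HC₁⋠P : ∀ m → ¬ (HC 1 ≼ P m)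
  HC₁⋠P m (σ , P≃HC₁) with σ (fs fz) | ¬atomic-image-of-z m P≃HC₁
  ... | inj₁ v | ¬z-atomic = ¬z-atomic (atomic-var v)
  ... | inj₂ a | ¬z-atomic = ¬z-atomic (atomic-const a)

lemma3 : ∀ {c ℓ : Level} (F : Field c ℓ) → ¬ Poly.InVNPC F (Poly.Pfam F)
lemma3 F (_ , t , _ , HC≼P) = Evaluation.HC₁⋠P F (t 1) (HC≼P 1)
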